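{- Let $W$ be the Weyl group of type $E_8$, let $u,v\in W$ be such that $AD(u,v)\neq\emptyset$ and let $t$ be a minimal element of $AD(u,v)$ with respect to $\preceq$. Then for every $r\in D(t)\setminus\{t\}$, $$r\in A(u)\iff r\in A(v)\iff r^t\in D(v)\iff r^t\in D(u),$$ where $r^t=trt$.
   Context: $W$ acts as a reflection group with root system of type $E_8$; fix a set of simple roots $\{\alpha_s:s\in S\}$ (so $(W,S)$ is a Coxeter system), and for each reflection $t\in T$ let $\alpha_t$ be its positive root. $r\preceq t$ iff $\alpha_t-\alpha_r$ is a nonnegative linear combination of simple roots. $D(w)=\{t\in T: wt<w\}$, $A(w)=\{t\in T:w<wt\}$ (Bruhat order), $AD(u,v)=A(u)\cap D(v)$. -}

module Defs where

open import Data.Nat as ℕ using (ℕ)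
open import Data.Integer using (ℤ; +_; -_; _+_; _*_; _-_; _≤_; 0ℤ)
open import Data.Fin using (Fin; toℕ; _≟_)
open import Data.Vec using (Vec; tabulate; lookup; zipWith; map; foldr)
open import Data.Vec.Relation.Unary.All using (All)
open import Data.List using (List; []; _∷_; _++_; reverse; length)
open import Data.Product using (Σ; ∃; _×_; _,_)
open import Data.Bool using (Bool; true; false; if_then_else_; _∨_)
open import Relation.Nullary using (¬_; does)
open import Relation.Binary.PropositionalEquality using (_≡_)
open import Relation.Binary.Construct.Closure.Transitive using (TransClosure)

-- The root system of type E8, in coordinates w.r.t. the simple roots
-- α₀,…,α₇ (Bourbaki labels 1..8 shifted down by one).
-- Dynkin edges (Bourbaki): 1-3, 3-4, 4-5, 5-6, 6-7, 7-8, 2-4.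

edge : ℕ → ℕ → Bool
edge 0 2 = true
edge 2 3 = true
edge 3 4 = true
edge 4 5 = true
edge 5 6 = true
edge 6 7 = true
edge 1 3 = true
edge _ _ = false

cartan : Fin 8 → Fin 8 → ℤ
cartan i j =
  if does (i ≟ j) then + 2
  else if edge (toℕ i) (toℕ j) ∨ edge (toℕ j) (toℕ i) then - (+ 1)
  else 0ℤ

V : Set
V = Vec ℤ 8

sumV : V → ℤ
sumV = foldr _ _+_ 0ℤ

form : V → V → ℤ
form x y = sumV (tabulate λ i → sumV (tabulate λ j → lookup x i * cartan i j * lookup y j))

_-V_ : V → V → V
x -V y = zipWith _-_ x y

_·V_ : ℤ → V → V
c ·V x = map (c *_) x

simple : Fin 8 → V
simple i = tabulate λ j → if does (i ≟ j) then + 1 else 0ℤ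

-- reflection in the root β (all roots have (β,β) = 2)
reflV : V → V → V
reflV β x = x -V (form β x ·V β)

-- The Weyl group W, as words in the simple reflections, acting on V.
-- The word i₁ i₂ … iₖ denotes s_{i₁} s_{i₂} ⋯ s_{iₖ}.

Word : Set
Word = List (Fin 8)

act : Word → V → V
act []      x = x
act (i ∷ w) x = reflV (simple i) (act w x)

-- equality in W: same linear transformation (faithful representation)
_≈_ : Word → Word → Set
w ≈ w' = ∀ x → act w x ≡ act w' x

_·_ : Word → Word → Word
w · w' = w ++ w'

conj : Word → Word → Word
conj r t = t ++ r ++ t

IsRoot : V → Set
IsRoot β = ∃ λ (u : Word) → ∃ λ (i : Fin 8) → act u (simple i) ≡ β

Nonneg : V → Set
Nonneg = All (0ℤ ≤_)

IsPosRoot : V → Set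
IsPosRoot β = IsRoot β × Nonneg β

HasRoot : Word → V → Set
HasRoot t β = IsPosRoot β × (∀ x → act t x ≡ reflV β x)

IsRefl : Word → Set
IsRefl t = ∃ λ β → HasRoot t β

_⪯_ : Word → Word → Set
r ⪯ t = ∃ λ αr → ∃ λ αt → HasRoot r αr × HasRoot t αt × Nonneg (αt -V αr)

HasLength : Word → ℕ → Set
HasLength w n =
  (∃ λ (u : Word) → u ≈ w × length u ≡ n) ×
  (∀ (u : Word) → u ≈ w → n ℕ.≤ length u)

BruhatStep : Word → Word → Set
BruhatStep w' w =
  (∃ λ t → IsRefl t × w ≈ (w' · t)) ×
  (∃ λ m → ∃ λ n → HasLength w' m × HasLength w n × m ℕ.< n)

_<B_ : Word → Word → Set
_<B_ = TransClosure BruhatStep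

InD : Word → Word → Set
InD w t = IsRefl t × ((w · t) <B w)

InA : Word → Word → Set
InA w t = IsRefl t × (w <B (w · t))

InAD : Word → Word → Word → Set
InAD u v t = InA u t × InD v t

MinimalAD : Word → Word → Word → Set
MinimalAD u v t = InAD u v t × (∀ r → InAD u v r → r ⪯ t → r ≈ t)

module Submission where

-- Write α_s for the positive root of a reflection s.  By the exchange lemma,
-- s ∈ A(w) iff w α_s > 0 and s ∈ D(w) iff w α_s < 0.  Since r ∈ D(t), the root
-- t α_r = α_r - (α_t, α_r) α_t is negative; as distinct roots of E8 pair to at
-- most 1, this forces (α_t, α_r) = 1, so α_{r^t} = -t α_r = α_t - α_r.  Hence
-- r, r^t ⪯ t, minimality of t keeps r and r^t out of AD(u,v), and
-- α_t = α_r + α_{r^t} together with u α_t > 0 > v α_t closes the cycle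
-- r ∈ A(u) ⇒ r ∈ A(v) ⇒ r^t ∈ D(v) ⇒ r^t ∈ D(u) ⇒ r ∈ A(u).
-- The root-system facts used (every root is positive or negative, s_i sends no
-- positive root other than α_i to a negative one, the pairing bound) are
-- checked by computation on the 240 roots.

open import Defs

open import Data.Bool using (if_then_else_)
import Data.Bool.Properties as Bool
open import Data.Empty using (⊥; ⊥-elim)
open import Data.Fin as Fin using (Fin)
import Data.Fin.Properties as Fin
open import Data.Integer as ℤ using (ℤ; +_; -[1+_]; -_; _+_; _-_; _*_; 0ℤ; _≤_; _≤?_)
import Data.Integer.Properties as ℤ
open import Data.Integer.Tactic.RingSolver using (solve-∀)
open import Data.List as List using (List; []; _∷_; _++_; length; reverse)
import Data.List.Properties as List
open import Data.Nat as ℕ using (ℕ; zero; suc; s≤s)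
import Data.Nat.Properties as ℕ
open import Data.Product using (_×_; ∃; _,_; proj₁; proj₂)
open import Data.Sum as Sum using (_⊎_; inj₁; inj₂)
open import Data.Vec as Vec using (Vec; []; _∷_; lookup; tabulate; zipWith)
import Data.Vec.Properties as Vec
open import Data.Vec.Relation.Unary.All as All using (All; []; _∷_)
open import Function using (_∘_; id)
open import Function.Bundles using (_⇔_; mk⇔; Equivalence)
open import Relation.Binary.Construct.Closure.Transitive using ([_]; _∷_)
open import Relation.Binary.Definitions using (DecidableEquality)
open import Relation.Binary.PropositionalEquality
open ≡-Reasoning
open import Relation.Nullary using (¬_; Dec; does; yes; no; contradiction)
open import Relation.Nullary.Decidable using (from-yes; map′; _⊎-dec_; _×-dec_; _→-dec_; ¬?)

open import Algebra.Properties.CommutativeMonoid.Sum ℤ.+-0-commutativeMonoid using (sum; sum-cong-≗; ∑-comm)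

-- The operations _-V_ and _·V_ of Defs in arbitrary dimension, so that
-- identities between vectors can be proved by induction on the dimension.
infixl 6 _-ᵥ_
infixr 7 _·ᵥ_

_-ᵥ_ : ∀ {n} → Vec ℤ n → Vec ℤ n → Vec ℤ n
_-ᵥ_ = zipWith _-_

_·ᵥ_ : ∀ {n} → ℤ → Vec ℤ n → Vec ℤ n
c ·ᵥ x = Vec.map (c *_) x

zeros : ∀ {n} → Vec ℤ n
zeros = tabulate λ _ → 0ℤ

-ᵥ-axpy-exchange : ∀ {n} (x y a : Vec ℤ n) c p q →
  (x -ᵥ c ·ᵥ y) -ᵥ (p - c * q) ·ᵥ a ≡ (x -ᵥ p ·ᵥ a) -ᵥ c ·ᵥ (y -ᵥ q ·ᵥ a)
-ᵥ-axpy-exchange []       []       []       c p q = refl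
-ᵥ-axpy-exchange (x ∷ xs) (y ∷ ys) (a ∷ as) c p q =
  cong₂ _∷_ (scalar x y a c p q) (-ᵥ-axpy-exchange xs ys as c p q)
  where
  scalar : ∀ x y a c p q → (x - c * y) - (p - c * q) * a ≡ (x - p * a) - c * (y - q * a)
  scalar = solve-∀

-ᵥ-axpy-cancel : ∀ {n} (z b : Vec ℤ n) p → (z -ᵥ p ·ᵥ b) -ᵥ (p - p * + 2) ·ᵥ b ≡ z
-ᵥ-axpy-cancel []       []       p = refl
-ᵥ-axpy-cancel (z ∷ zs) (b ∷ bs) p = cong₂ _∷_ (scalar z b p) (-ᵥ-axpy-cancel zs bs p)
  where
  scalar : ∀ z b p → (z - p * b) - (p - p * + 2) * b ≡ z
  scalar = solve-∀

-ᵥ-axpy-negated : ∀ {n} (x b : Vec ℤ n) p → x -ᵥ (p - + 2 * p) ·ᵥ (b -ᵥ + 2 ·ᵥ b) ≡ x -ᵥ p ·ᵥ b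
-ᵥ-axpy-negated []       []       p = refl
-ᵥ-axpy-negated (x ∷ xs) (b ∷ bs) p = cong₂ _∷_ (scalar x b p) (-ᵥ-axpy-negated xs bs p)
  where
  scalar : ∀ x b p → x - (p - + 2 * p) * (b - + 2 * b) ≡ x - p * b
  scalar = solve-∀

-ᵥ-self : ∀ {n} (x : Vec ℤ n) → x -ᵥ + 1 ·ᵥ x ≡ zeros
-ᵥ-self []       = refl
-ᵥ-self (x ∷ xs) = cong₂ _∷_ (scalar x) (-ᵥ-self xs)
  where
  scalar : ∀ x → x - + 1 * x ≡ 0ℤ
  scalar = solve-∀

0≡0-c*0 : ∀ c → 0ℤ ≡ 0ℤ - c * 0ℤ
0≡0-c*0 = solve-∀

-ᵥ-zeros : ∀ {n} (x : Vec ℤ n) c → x ≡ x -ᵥ c ·ᵥ zeros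
-ᵥ-zeros []       c = refl
-ᵥ-zeros (x ∷ xs) c = cong₂ _∷_ (scalar x c) (-ᵥ-zeros xs c)
  where
  scalar : ∀ x c → x ≡ x - c * 0ℤ
  scalar = solve-∀

-ᵥ-as-axpy : ∀ {n} (x y : Vec ℤ n) → x -ᵥ y ≡ x -ᵥ + 1 ·ᵥ y
-ᵥ-as-axpy []       []       = refl
-ᵥ-as-axpy (x ∷ xs) (y ∷ ys) = cong₂ _∷_ (scalar x y) (-ᵥ-as-axpy xs ys)
  where
  scalar : ∀ x y → x - y ≡ x - + 1 * y
  scalar = solve-∀

-ᵥ-complement : ∀ {n} (x y : Vec ℤ n) → x -ᵥ (x -ᵥ y) ≡ y
-ᵥ-complement []       []       = refl
-ᵥ-complement (x ∷ xs) (y ∷ ys) = cong₂ _∷_ (scalar x y) (-ᵥ-complement xs ys)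
  where
  scalar : ∀ x y → x - (x - y) ≡ y
  scalar = solve-∀

-ᵥ-negated : ∀ {n} (x y : Vec ℤ n) → (y -ᵥ + 1 ·ᵥ x) -ᵥ + 2 ·ᵥ (y -ᵥ + 1 ·ᵥ x) ≡ x -ᵥ y
-ᵥ-negated []       []       = refl
-ᵥ-negated (x ∷ xs) (y ∷ ys) = cong₂ _∷_ (scalar x y) (-ᵥ-negated xs ys)
  where
  scalar : ∀ x y → (y - + 1 * x) - + 2 * (y - + 1 * x) ≡ x - y
  scalar = solve-∀

Nonpos : ∀ {n} → Vec ℤ n → Set
Nonpos = All (_≤ 0ℤ)

a-2a≡-a : ∀ a → a - + 2 * a ≡ - a
a-2a≡-a = solve-∀

negated-nonpos : ∀ {a} → 0ℤ ≤ a → a - + 2 * a ≤ 0ℤ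
negated-nonpos {a} 0≤a = subst (_≤ 0ℤ) (sym (a-2a≡-a a)) (ℤ.neg-mono-≤ 0≤a)

negated-nonneg : ∀ {a} → a ≤ 0ℤ → 0ℤ ≤ a - + 2 * a
negated-nonneg {a} a≤0 = subst (0ℤ ≤_) (sym (a-2a≡-a a)) (ℤ.neg-mono-≤ a≤0)

axpy-nonneg : ∀ {c a b} → c ≤ 0ℤ → 0ℤ ≤ a → 0ℤ ≤ b → 0ℤ ≤ a - c * b
axpy-nonneg {c} {a} {+ n} c≤0 0≤a _ = ℤ.i≤j⇒0≤j-i (ℤ.≤-trans (ℤ.*-monoʳ-≤-nonNeg (+ n) c≤0) 0≤a)

Nonneg-axpy : ∀ {n} {c} {x y : Vec ℤ n} → c ≤ 0ℤ → All (0ℤ ≤_) x → All (0ℤ ≤_) y →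
  All (0ℤ ≤_) (x -ᵥ c ·ᵥ y)
Nonneg-axpy c≤0 []         []         = []
Nonneg-axpy c≤0 (0≤a ∷ x≥0) (0≤b ∷ y≥0) = axpy-nonneg c≤0 0≤a 0≤b ∷ Nonneg-axpy c≤0 x≥0 y≥0

Nonneg-negated : ∀ {n} {x : Vec ℤ n} → Nonpos x → All (0ℤ ≤_) (x -ᵥ + 2 ·ᵥ x)
Nonneg-negated []          = []
Nonneg-negated (a≤0 ∷ x≤0) = negated-nonneg a≤0 ∷ Nonneg-negated x≤0

Nonpos-negated : ∀ {n} {x : Vec ℤ n} → All (0ℤ ≤_) x → Nonpos (x -ᵥ + 2 ·ᵥ x)
Nonpos-negated []          = []
Nonpos-negated (0≤a ∷ x≥0) = negated-nonpos 0≤a ∷ Nonpos-negated x≥0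

Nonpos-sub : ∀ {n} {x y : Vec ℤ n} → Nonpos x → All (0ℤ ≤_) y → Nonpos (x -ᵥ y)
Nonpos-sub = All.zipWith λ a≤0 0≤b → ℤ.i≤j⇒i-j≤0 (ℤ.≤-trans a≤0 0≤b)

Nonneg-sub : ∀ {n} {x y : Vec ℤ n} → All (0ℤ ≤_) x → Nonpos y → All (0ℤ ≤_) (x -ᵥ y)
Nonneg-sub = All.zipWith λ 0≤a b≤0 → ℤ.i≤j⇒0≤j-i (ℤ.≤-trans b≤0 0≤a)

-- At n = 8 this is `simple`.
unit : ∀ {n} → Fin n → Vec ℤ n
unit i = tabulate λ j → if does (i Fin.≟ j) then + 1 else 0ℤ

Linear : ∀ {n} → (Vec ℤ n → V) → Set
Linear f = ∀ x y c → f (x -ᵥ c ·ᵥ y) ≡ f x -V (c ·V f y)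

linear-zero : ∀ {f : Vec ℤ 0 → V} → Linear f → f [] ≡ zeros
linear-zero {f} lin = trans (lin [] [] (+ 1)) (-ᵥ-self (f []))

linear-tail : ∀ {n} {f : Vec ℤ (suc n) → V} → Linear f → Linear (f ∘ (0ℤ ∷_))
linear-tail {f = f} lin x y c =
  trans (cong (λ z → f (z ∷ x -ᵥ c ·ᵥ y)) (0≡0-c*0 c)) (lin (0ℤ ∷ x) (0ℤ ∷ y) c)

linear-unique : ∀ {n} {f g : Vec ℤ n → V} → Linear f → Linear g →
  (∀ i → f (unit i) ≡ g (unit i)) → ∀ x → f x ≡ g x
linear-unique {zero}          linf ling _     [] = trans (linear-zero linf) (sym (linear-zero ling))
linear-unique {suc n} {f} {g} linf ling agree (x ∷ xs) = begin
  f (x ∷ xs)                                  ≡⟨ cong f split ⟩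
  f ((0ℤ ∷ xs) -ᵥ (- x) ·ᵥ unit Fin.zero)     ≡⟨ linf (0ℤ ∷ xs) (unit Fin.zero) (- x) ⟩
  f (0ℤ ∷ xs) -V ((- x) ·V f (unit Fin.zero)) ≡⟨ cong₂ (λ a b → a -V ((- x) ·V b)) tails (agree Fin.zero) ⟩
  g (0ℤ ∷ xs) -V ((- x) ·V g (unit Fin.zero)) ≡⟨ ling (0ℤ ∷ xs) (unit Fin.zero) (- x) ⟨
  g ((0ℤ ∷ xs) -ᵥ (- x) ·ᵥ unit Fin.zero)     ≡⟨ cong g split ⟨
  g (x ∷ xs)                                  ∎
  where
  scalar : ∀ x → x ≡ 0ℤ - (- x) * + 1
  scalar = solve-∀
  split : x ∷ xs ≡ (0ℤ ∷ xs) -ᵥ (- x) ·ᵥ unit Fin.zero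
  split = cong₂ _∷_ (scalar x) (-ᵥ-zeros xs (- x))
  tails : f (0ℤ ∷ xs) ≡ g (0ℤ ∷ xs)
  tails = linear-unique (linear-tail linf) (linear-tail ling) (agree ∘ Fin.suc) xs

-- The bilinear form and reflections

∑-axpy : ∀ {n} (f g : Fin n → ℤ) c → sum (λ i → f i - c * g i) ≡ sum f - c * sum g
∑-axpy {zero}  f g c = 0≡0-c*0 c
∑-axpy {suc n} f g c = trans (cong (_+_ (f Fin.zero - c * g Fin.zero)) (∑-axpy (f ∘ Fin.suc) (g ∘ Fin.suc) c))
                             (scalar (f Fin.zero) (g Fin.zero) (sum (f ∘ Fin.suc)) (sum (g ∘ Fin.suc)) c)
  where
  scalar : ∀ a b s t c → a - c * b + (s - c * t) ≡ (a + s) - c * (b + t)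
  scalar = solve-∀

lookup-axpy : ∀ {n} (x y : Vec ℤ n) c i → lookup (x -ᵥ c ·ᵥ y) i ≡ lookup x i - c * lookup y i
lookup-axpy x y c i = trans (Vec.lookup-zipWith _-_ i x (c ·ᵥ y)) (cong (_-_ (lookup x i)) (Vec.lookup-map i (c *_) y))

form-axpyʳ : ∀ a x y c → form a (x -V (c ·V y)) ≡ form a x - c * form a y
form-axpyʳ a x y c = begin
  form a (x -V (c ·V y))                  ≡⟨ sum-cong-≗ (λ i → sum-cong-≗ (summand i)) ⟩
  sum (λ i → sum λ j → p i j - c * q i j) ≡⟨ sum-cong-≗ (λ i → ∑-axpy (p i) (q i) c) ⟩
  sum (λ i → sum (p i) - c * sum (q i))   ≡⟨ ∑-axpy (sum ∘ p) (sum ∘ q) c ⟩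
  form a x - c * form a y                 ∎
  where
  p q : Fin 8 → Fin 8 → ℤ
  p i j = lookup a i * cartan i j * lookup x j
  q i j = lookup a i * cartan i j * lookup y j
  scalar : ∀ a m x y c → a * m * (x - c * y) ≡ a * m * x - c * (a * m * y)
  scalar = solve-∀
  summand : ∀ i j → lookup a i * cartan i j * lookup (x -V (c ·V y)) j ≡ p i j - c * q i j
  summand i j = trans (cong (lookup a i * cartan i j *_) (lookup-axpy x y c j))
                      (scalar (lookup a i) (cartan i j) (lookup x j) (lookup y j) c)

cartan-sym : ∀ i j → cartan i j ≡ cartan j i
cartan-sym i j with i Fin.≟ j | j Fin.≟ i
... | yes refl | yes _    = refl
... | yes refl | no i≢i   = contradiction refl i≢i
... | no i≢i   | yes refl = contradiction refl i≢i
... | no _     | no _     = cong (if_then - (+ 1) else 0ℤ) (Bool.∨-comm (edge (Fin.toℕ i) (Fin.toℕ j)) _)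

form-sym : ∀ x y → form x y ≡ form y x
form-sym x y = trans (∑-comm λ i j → lookup x i * cartan i j * lookup y j)
                     (sum-cong-≗ λ j → sum-cong-≗ λ i → summand i j)
  where
  scalar : ∀ a m b → a * m * b ≡ b * m * a
  scalar = solve-∀
  summand : ∀ i j → lookup x i * cartan i j * lookup y j ≡ lookup y j * cartan j i * lookup x i
  summand i j = trans (scalar (lookup x i) (cartan i j) (lookup y j))
                      (cong (λ m → lookup y j * m * lookup x i) (cartan-sym i j))

form-axpyˡ : ∀ x y a c → form (x -V (c ·V y)) a ≡ form x a - c * form y a
form-axpyˡ x y a c = begin
  form (x -V (c ·V y)) a   ≡⟨ form-sym (x -V (c ·V y)) a ⟩
  form a (x -V (c ·V y))   ≡⟨ form-axpyʳ a x y c ⟩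
  form a x - c * form a y  ≡⟨ cong₂ (λ p q → p - c * q) (form-sym a x) (form-sym a y) ⟩
  form x a - c * form y a  ∎

reflV-axpy : ∀ a x y c → reflV a (x -V (c ·V y)) ≡ reflV a x -V (c ·V reflV a y)
reflV-axpy a x y c = trans (cong (λ p → (x -V (c ·V y)) -V (p ·V a)) (form-axpyʳ a x y c))
                           (-ᵥ-axpy-exchange x y a c (form a x) (form a y))

reflV-involutive : ∀ {a} → form a a ≡ + 2 → ∀ x → reflV a (reflV a x) ≡ x
reflV-involutive {a} aa x = begin
  reflV a (x -V (p ·V a))
    ≡⟨ cong (λ q → (x -V (p ·V a)) -V (q ·V a)) (form-axpyʳ a x a p) ⟩
  (x -V (p ·V a)) -V ((p - p * form a a) ·V a)
    ≡⟨ cong (λ n → (x -V (p ·V a)) -V ((p - p * n) ·V a)) aa ⟩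
  (x -V (p ·V a)) -V ((p - p * + 2) ·V a)
    ≡⟨ -ᵥ-axpy-cancel x a p ⟩
  x ∎
  where
  p = form a x

reflV-isometry : ∀ {a} → form a a ≡ + 2 → ∀ x y → form (reflV a x) (reflV a y) ≡ form x y
reflV-isometry {a} aa x y = begin
  form (x -V (p ·V a)) (y -V (q ·V a))
    ≡⟨ form-axpyʳ (x -V (p ·V a)) y a q ⟩
  form (x -V (p ·V a)) y - q * form (x -V (p ·V a)) a
    ≡⟨ cong₂ (λ m n → m - q * n) (form-axpyˡ x a y p) (form-axpyˡ x a a p) ⟩
  (form x y - p * q) - q * (form x a - p * form a a)
    ≡⟨ cong₂ (λ m n → (form x y - p * q) - q * (m - p * n)) (form-sym x a) aa ⟩
  (form x y - p * q) - q * (p - p * + 2)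
    ≡⟨ scalar (form x y) p q ⟩
  form x y ∎
  where
  p = form a x
  q = form a y
  scalar : ∀ f p q → (f - p * q) - q * (p - p * + 2) ≡ f
  scalar = solve-∀

-- Negation is written a -V ((+ 2) ·V a), which is reflV a a for a root a.
reflV-self : ∀ {a} → form a a ≡ + 2 → reflV a a ≡ a -V ((+ 2) ·V a)
reflV-self {a} aa = cong (λ n → a -V (n ·V a)) aa

reflV-negated : ∀ a x → reflV (a -V ((+ 2) ·V a)) x ≡ reflV a x
reflV-negated a x = trans (cong (λ p → x -V (p ·V (a -V ((+ 2) ·V a)))) (form-axpyˡ a a x (+ 2)))
                          (-ᵥ-axpy-negated x a (form a x))

-- The Weyl group acting on the root lattice

_≟V_ : DecidableEquality V
_≟V_ = Vec.≡-dec ℤ._≟_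

simple-norm : ∀ i → form (simple i) (simple i) ≡ + 2
simple-norm = from-yes (Fin.all? λ i → form (simple i) (simple i) ℤ.≟ + 2)

act-++ : ∀ u w x → act (u ++ w) x ≡ act u (act w x)
act-++ []      w x = refl
act-++ (i ∷ u) w x = cong (reflV (simple i)) (act-++ u w x)

act-axpy : ∀ u x y c → act u (x -V (c ·V y)) ≡ act u x -V (c ·V act u y)
act-axpy []      x y c = refl
act-axpy (i ∷ u) x y c = trans (cong (reflV (simple i)) (act-axpy u x y c))
                               (reflV-axpy (simple i) (act u x) (act u y) c)

act-isometry : ∀ u x y → form (act u x) (act u y) ≡ form x y
act-isometry []      x y = refl
act-isometry (i ∷ u) x y = trans (reflV-isometry {simple i} (simple-norm i) (act u x) (act u y)) (act-isometry u x y)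

act-reflV : ∀ u a y → act u (reflV a y) ≡ reflV (act u a) (act u y)
act-reflV u a y = trans (act-axpy u y a (form a y))
                        (cong (λ c → act u y -V (c ·V act u a)) (sym (act-isometry u a y)))

act-reverse : ∀ u x → act u (act (reverse u) x) ≡ x
act-reverse []      x = refl
act-reverse (i ∷ u) x = begin
  act (i ∷ u) (act (reverse (i ∷ u)) x)
    ≡⟨ cong (act (i ∷ u)) reverse-∷ ⟩
  act (i ∷ u) (act (reverse u) (reflV (simple i) x))
    ≡⟨ cong (reflV (simple i)) (act-reverse u (reflV (simple i) x)) ⟩
  reflV (simple i) (reflV (simple i) x)
    ≡⟨ reflV-involutive {simple i} (simple-norm i) x ⟩
  x ∎
  where
  reverse-∷ : act (reverse (i ∷ u)) x ≡ act (reverse u) (reflV (simple i) x)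
  reverse-∷ = trans (cong (λ w → act w x) (List.unfold-reverse i u)) (act-++ (reverse u) (i ∷ []) x)

act-adjoint : ∀ u x y → form (act u x) y ≡ form x (act (reverse u) y)
act-adjoint u x y = begin
  form (act u x) y                           ≡⟨ cong (form (act u x)) (act-reverse u y) ⟨
  form (act u x) (act u (act (reverse u) y)) ≡⟨ act-isometry u x (act (reverse u) y) ⟩
  form x (act (reverse u) y)                 ∎

act-sub : ∀ u x y → act u (x -V y) ≡ act u x -V act u y
act-sub u x y = begin
  act u (x -V y)                  ≡⟨ cong (act u) (-ᵥ-as-axpy x y) ⟩
  act u (x -V ((+ 1) ·V y))       ≡⟨ act-axpy u x y (+ 1) ⟩
  act u x -V ((+ 1) ·V act u y)   ≡⟨ -ᵥ-as-axpy (act u x) (act u y) ⟨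
  act u x -V act u y              ∎

act-conj : ∀ r t x → act (conj r t) x ≡ act t (act r (act t x))
act-conj r t x = trans (act-++ t (r ++ t) x) (cong (act t) (act-++ r t x))

_≈?_ : ∀ u w → Dec (u ≈ w)
u ≈? w = map′ (linear-unique (act-axpy u) (act-axpy w)) (λ u≈w i → u≈w (simple i))
              (Fin.all? λ i → act u (simple i) ≟V act w (simple i))

-- The 240 roots of E8

Row : Set
Row = V × Vec (Fin 240) 8

row : (a b c d e f g h : ℕ) (i₀ i₁ i₂ i₃ i₄ i₅ i₆ i₇ : Fin 240) → Row
row a b c d e f g h i₀ i₁ i₂ i₃ i₄ i₅ i₆ i₇ =
  (+ a ∷ + b ∷ + c ∷ + d ∷ + e ∷ + f ∷ + g ∷ + h ∷ []) ,
  (i₀ ∷ i₁ ∷ i₂ ∷ i₃ ∷ i₄ ∷ i₅ ∷ i₆ ∷ i₇ ∷ [])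

module PositiveRoots where
  open import Agda.Builtin.FromNat using (Number; fromNat)
  import Data.Nat.Literals as ℕ
  import Data.Fin.Literals as Fin
  open import Data.Unit using (tt)

  instance
    ℕ-number : Number ℕ
    ℕ-number = ℕ.number
    Fin240-number : Number (Fin 240)
    Fin240-number = Fin.number 240

  -- Row k: the coordinates of the k-th positive root, then the indices of its
  -- images under s₀, …, s₇ in the enumeration `root` below, which lists the
  -- positive roots followed by their negatives.
  positiveRoots : Vec Row 120
  positiveRoots =
    row 1 0 0 0 0 0 0 0   120 0 8 0 0 0 0 0 ∷
    row 0 1 0 0 0 0 0 0   1 121 1 9 1 1 1 1 ∷
    row 0 0 1 0 0 0 0 0   8 2 122 10 2 2 2 2 ∷
    row 0 0 0 1 0 0 0 0   3 9 10 123 11 3 3 3 ∷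
    row 0 0 0 0 1 0 0 0   4 4 4 11 124 12 4 4 ∷
    row 0 0 0 0 0 1 0 0   5 5 5 5 12 125 13 5 ∷
    row 0 0 0 0 0 0 1 0   6 6 6 6 6 13 126 14 ∷
    row 0 0 0 0 0 0 0 1   7 7 7 7 7 7 14 127 ∷
    row 1 0 1 0 0 0 0 0   2 8 0 15 8 8 8 8 ∷
    row 0 1 0 1 0 0 0 0   9 3 16 1 17 9 9 9 ∷
    row 0 0 1 1 0 0 0 0   15 16 3 2 18 10 10 10 ∷
    row 0 0 0 1 1 0 0 0   11 17 18 4 3 19 11 11 ∷
    row 0 0 0 0 1 1 0 0   12 12 12 19 5 4 20 12 ∷
    row 0 0 0 0 0 1 1 0   13 13 13 13 20 6 5 21 ∷
    row 0 0 0 0 0 0 1 1   14 14 14 14 14 21 7 6 ∷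
    row 1 0 1 1 0 0 0 0   10 22 15 8 23 15 15 15 ∷
    row 0 1 1 1 0 0 0 0   22 10 9 16 24 16 16 16 ∷
    row 0 1 0 1 1 0 0 0   17 11 24 17 9 25 17 17 ∷
    row 0 0 1 1 1 0 0 0   23 24 11 18 10 26 18 18 ∷
    row 0 0 0 1 1 1 0 0   19 25 26 12 19 11 27 19 ∷
    row 0 0 0 0 1 1 1 0   20 20 20 27 13 20 12 28 ∷
    row 0 0 0 0 0 1 1 1   21 21 21 21 28 14 21 13 ∷
    row 1 1 1 1 0 0 0 0   16 15 22 22 29 22 22 22 ∷
    row 1 0 1 1 1 0 0 0   18 29 23 23 15 30 23 23 ∷
    row 0 1 1 1 1 0 0 0   29 18 17 31 16 32 24 24 ∷
    row 0 1 0 1 1 1 0 0   25 19 32 25 25 17 33 25 ∷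
    row 0 0 1 1 1 1 0 0   30 32 19 26 26 18 34 26 ∷
    row 0 0 0 1 1 1 1 0   27 33 34 20 27 27 19 35 ∷
    row 0 0 0 0 1 1 1 1   28 28 28 35 21 28 28 20 ∷
    row 1 1 1 1 1 0 0 0   24 23 29 36 22 37 29 29 ∷
    row 1 0 1 1 1 1 0 0   26 37 30 30 30 23 38 30 ∷
    row 0 1 1 2 1 0 0 0   36 31 31 24 31 39 31 31 ∷
    row 0 1 1 1 1 1 0 0   37 26 25 39 32 24 40 32 ∷
    row 0 1 0 1 1 1 1 0   33 27 40 33 33 33 25 41 ∷
    row 0 0 1 1 1 1 1 0   38 40 27 34 34 34 26 42 ∷
    row 0 0 0 1 1 1 1 1   35 41 42 28 35 35 35 27 ∷
    row 1 1 1 2 1 0 0 0   31 36 43 29 36 44 36 36 ∷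
    row 1 1 1 1 1 1 0 0   32 30 37 44 37 29 45 37 ∷
    row 1 0 1 1 1 1 1 0   34 45 38 38 38 38 30 46 ∷
    row 0 1 1 2 1 1 0 0   44 39 39 32 47 31 48 39 ∷
    row 0 1 1 1 1 1 1 0   45 34 33 48 40 40 32 49 ∷
    row 0 1 0 1 1 1 1 1   41 35 49 41 41 41 41 33 ∷
    row 0 0 1 1 1 1 1 1   46 49 35 42 42 42 42 34 ∷
    row 1 1 2 2 1 0 0 0   43 43 36 43 43 50 43 43 ∷
    row 1 1 1 2 1 1 0 0   39 44 50 37 51 36 52 44 ∷
    row 1 1 1 1 1 1 1 0   40 38 45 52 45 45 37 53 ∷
    row 1 0 1 1 1 1 1 1   42 53 46 46 46 46 46 38 ∷
    row 0 1 1 2 2 1 0 0   51 47 47 47 39 47 54 47 ∷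
    row 0 1 1 2 1 1 1 0   52 48 48 40 54 48 39 55 ∷
    row 0 1 1 1 1 1 1 1   53 42 41 55 49 49 49 40 ∷
    row 1 1 2 2 1 1 0 0   50 50 44 50 56 43 57 50 ∷
    row 1 1 1 2 2 1 0 0   47 51 56 51 44 51 58 51 ∷
    row 1 1 1 2 1 1 1 0   48 52 57 45 58 52 44 59 ∷
    row 1 1 1 1 1 1 1 1   49 46 53 59 53 53 53 45 ∷
    row 0 1 1 2 2 1 1 0   58 54 54 54 48 60 47 61 ∷
    row 0 1 1 2 1 1 1 1   59 55 55 49 61 55 55 48 ∷
    row 1 1 2 2 2 1 0 0   56 56 51 62 50 56 63 56 ∷
    row 1 1 2 2 1 1 1 0   57 57 52 57 63 57 50 64 ∷
    row 1 1 1 2 2 1 1 0   54 58 63 58 52 65 51 66 ∷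
    row 1 1 1 2 1 1 1 1   55 59 64 53 66 59 59 52 ∷
    row 0 1 1 2 2 2 1 0   65 60 60 60 60 54 60 67 ∷
    row 0 1 1 2 2 1 1 1   66 61 61 61 55 67 61 54 ∷
    row 1 1 2 3 2 1 0 0   62 68 62 56 62 62 69 62 ∷
    row 1 1 2 2 2 1 1 0   63 63 58 69 57 70 56 71 ∷
    row 1 1 2 2 1 1 1 1   64 64 59 64 71 64 64 57 ∷
    row 1 1 1 2 2 2 1 0   60 65 70 65 65 58 65 72 ∷
    row 1 1 1 2 2 1 1 1   61 66 71 66 59 72 66 58 ∷
    row 0 1 1 2 2 2 1 1   72 67 67 67 67 61 73 60 ∷
    row 1 2 2 3 2 1 0 0   68 62 68 68 68 68 74 68 ∷
    row 1 1 2 3 2 1 1 0   69 74 69 63 69 75 62 76 ∷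
    row 1 1 2 2 2 2 1 0   70 70 65 75 70 63 70 77 ∷
    row 1 1 2 2 2 1 1 1   71 71 66 76 64 77 71 63 ∷
    row 1 1 1 2 2 2 1 1   67 72 77 72 72 66 78 65 ∷
    row 0 1 1 2 2 2 2 1   78 73 73 73 73 73 67 73 ∷
    row 1 2 2 3 2 1 1 0   74 69 74 74 74 79 68 80 ∷
    row 1 1 2 3 2 2 1 0   75 79 75 70 81 69 75 82 ∷
    row 1 1 2 3 2 1 1 1   76 80 76 71 76 82 76 69 ∷
    row 1 1 2 2 2 2 1 1   77 77 72 82 77 71 83 70 ∷
    row 1 1 1 2 2 2 2 1   73 78 83 78 78 78 72 78 ∷
    row 1 2 2 3 2 2 1 0   79 75 79 79 84 74 79 85 ∷
    row 1 2 2 3 2 1 1 1   80 76 80 80 80 85 80 74 ∷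
    row 1 1 2 3 3 2 1 0   81 84 81 81 75 81 81 86 ∷
    row 1 1 2 3 2 2 1 1   82 85 82 77 86 76 87 75 ∷
    row 1 1 2 2 2 2 2 1   83 83 78 87 83 83 77 83 ∷
    row 1 2 2 3 3 2 1 0   84 81 84 88 79 84 84 89 ∷
    row 1 2 2 3 2 2 1 1   85 82 85 85 89 80 90 79 ∷
    row 1 1 2 3 3 2 1 1   86 89 86 86 82 86 91 81 ∷
    row 1 1 2 3 2 2 2 1   87 90 87 83 91 87 82 87 ∷
    row 1 2 2 4 3 2 1 0   88 88 92 84 88 88 88 93 ∷
    row 1 2 2 3 3 2 1 1   89 86 89 93 85 89 94 84 ∷
    row 1 2 2 3 2 2 2 1   90 87 90 90 94 90 85 90 ∷
    row 1 1 2 3 3 2 2 1   91 94 91 91 87 95 86 91 ∷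
    row 1 2 3 4 3 2 1 0   96 92 88 92 92 92 92 97 ∷
    row 1 2 2 4 3 2 1 1   93 93 97 89 93 93 98 88 ∷
    row 1 2 2 3 3 2 2 1   94 91 94 98 90 99 89 94 ∷
    row 1 1 2 3 3 3 2 1   95 99 95 95 95 91 95 95 ∷
    row 2 2 3 4 3 2 1 0   92 96 96 96 96 96 96 100 ∷
    row 1 2 3 4 3 2 1 1   100 97 93 97 97 97 101 92 ∷
    row 1 2 2 4 3 2 2 1   98 98 101 94 98 102 93 98 ∷
    row 1 2 2 3 3 3 2 1   99 95 99 102 99 94 99 99 ∷
    row 2 2 3 4 3 2 1 1   97 100 100 100 100 100 103 96 ∷
    row 1 2 3 4 3 2 2 1   103 101 98 101 101 104 97 101 ∷
    row 1 2 2 4 3 3 2 1   102 102 104 99 105 98 102 102 ∷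
    row 2 2 3 4 3 2 2 1   101 103 103 103 103 106 100 103 ∷
    row 1 2 3 4 3 3 2 1   106 104 102 104 107 101 104 104 ∷
    row 1 2 2 4 4 3 2 1   105 105 107 105 102 105 105 105 ∷
    row 2 2 3 4 3 3 2 1   104 106 106 106 108 103 106 106 ∷
    row 1 2 3 4 4 3 2 1   108 107 105 109 104 107 107 107 ∷
    row 2 2 3 4 4 3 2 1   107 108 108 110 106 108 108 108 ∷
    row 1 2 3 5 4 3 2 1   110 111 109 107 109 109 109 109 ∷
    row 2 2 3 5 4 3 2 1   109 112 113 108 110 110 110 110 ∷
    row 1 3 3 5 4 3 2 1   112 109 111 111 111 111 111 111 ∷
    row 2 3 3 5 4 3 2 1   111 110 114 112 112 112 112 112 ∷
    row 2 2 4 5 4 3 2 1   113 114 110 113 113 113 113 113 ∷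
    row 2 3 4 5 4 3 2 1   114 113 112 115 114 114 114 114 ∷
    row 2 3 4 6 4 3 2 1   115 115 115 114 116 115 115 115 ∷
    row 2 3 4 6 5 3 2 1   116 116 116 116 115 117 116 116 ∷
    row 2 3 4 6 5 4 2 1   117 117 117 117 117 116 118 117 ∷
    row 2 3 4 6 5 4 3 1   118 118 118 118 118 118 117 119 ∷
    row 2 3 4 6 5 4 3 2   119 119 119 119 119 119 119 118 ∷
    []

open PositiveRoots using (positiveRoots)

root : Fin 240 → V
root n with Fin.splitAt 120 n
... | inj₁ k = proj₁ (lookup positiveRoots k)
... | inj₂ k = Vec.map -_ (proj₁ (lookup positiveRoots k))

image : Fin 240 → Fin 8 → Fin 240
image n j with Fin.splitAt 120 n
... | inj₁ k = lookup (proj₂ (lookup positiveRoots k)) j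
... | inj₂ k = Fin.join 120 120 (Sum.swap (Fin.splitAt 120 (lookup (proj₂ (lookup positiveRoots k)) j)))

nonneg? : (x : V) → Dec (Nonneg x)
nonneg? = All.all? (0ℤ ≤?_)

nonpos? : (x : V) → Dec (Nonpos x)
nonpos? = All.all? (_≤? 0ℤ)

table-simple : ∀ i → root (i Fin.↑ˡ 232) ≡ simple i
table-simple = from-yes (Fin.all? λ i → root (i Fin.↑ˡ 232) ≟V simple i)

table-reflect : ∀ n j → reflV (simple j) (root n) ≡ root (image n j)
table-reflect = from-yes (Fin.all? λ n → Fin.all? λ j → reflV (simple j) (root n) ≟V root (image n j))

table-sign : ∀ n → Nonneg (root n) ⊎ Nonpos (root n)
table-sign = from-yes (Fin.all? λ n → nonneg? (root n) ⊎-dec nonpos? (root n))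

table-sign-unique : ∀ n → ¬ (Nonneg (root n) × Nonpos (root n))
table-sign-unique = from-yes (Fin.all? λ n → ¬? (nonneg? (root n) ×-dec nonpos? (root n)))

table-exchange : ∀ n j → Nonneg (root n) → Nonpos (root (image n j)) → root n ≡ simple j
table-exchange = from-yes (Fin.all? λ n → Fin.all? λ j →
  nonneg? (root n) →-dec (nonpos? (root (image n j)) →-dec (root n ≟V simple j)))

table-pairing : ∀ n j → root n ≡ simple j ⊎ form (simple j) (root n) ≤ + 1
table-pairing = from-yes (Fin.all? λ n → Fin.all? λ j →
  (root n ≟V simple j) ⊎-dec (form (simple j) (root n) ≤? + 1))

Listed : V → Set
Listed x = ∃ λ n → root n ≡ x

listed-reflV : ∀ j {x} → Listed x → Listed (reflV (simple j) x)
listed-reflV j (n , refl) = image n j , sym (table-reflect n j)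

listed-root : ∀ {β} → IsRoot β → Listed β
listed-root (u , i , refl) = go u
  where
  go : ∀ u → Listed (act u (simple i))
  go []      = i Fin.↑ˡ 232 , table-simple i
  go (j ∷ u) = listed-reflV j (go u)

listed-sign : ∀ {x} → Listed x → Nonneg x ⊎ Nonpos x
listed-sign (n , refl) = table-sign n

listed-sign-unique : ∀ {x} → Listed x → Nonneg x → Nonpos x → ⊥
listed-sign-unique (n , refl) x≥0 x≤0 = table-sign-unique n (x≥0 , x≤0)

listed-exchange : ∀ {x} i → Listed x → Nonneg x → Nonpos (reflV (simple i) x) → x ≡ simple i
listed-exchange i (n , refl) x≥0 sx≤0 = table-exchange n i x≥0 (subst Nonpos (table-reflect n i) sx≤0)

listed-pairing : ∀ {x} i → Listed x → x ≡ simple i ⊎ form (simple i) x ≤ + 1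
listed-pairing i (n , refl) = table-pairing n i

root-act : ∀ w {β} → IsRoot β → IsRoot (act w β)
root-act w (u , i , refl) = w ++ u , i , act-++ w u (simple i)

root-norm : ∀ {β} → IsRoot β → form β β ≡ + 2
root-norm (u , i , refl) = trans (act-isometry u (simple i) (simple i)) (simple-norm i)

root-negated : ∀ {β} → IsRoot β → IsRoot (β -V ((+ 2) ·V β))
root-negated (u , i , refl) = u ++ i ∷ [] , i , (begin
  act (u ++ i ∷ []) (simple i)                    ≡⟨ act-++ u (i ∷ []) (simple i) ⟩
  act u (reflV (simple i) (simple i))             ≡⟨ cong (act u) (reflV-self {simple i} (simple-norm i)) ⟩
  act u (simple i -V ((+ 2) ·V simple i))         ≡⟨ act-axpy u (simple i) (simple i) (+ 2) ⟩
  act u (simple i) -V ((+ 2) ·V act u (simple i)) ∎)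

root-sign : ∀ {β} → IsRoot β → Nonneg β ⊎ Nonpos β
root-sign = listed-sign ∘ listed-root

root-sign-unique : ∀ {β} → IsRoot β → Nonneg β → Nonpos β → ⊥
root-sign-unique = listed-sign-unique ∘ listed-root

simple-exchange : ∀ {β} i → IsRoot β → Nonneg β → Nonpos (reflV (simple i) β) → β ≡ simple i
simple-exchange i = listed-exchange i ∘ listed-root

root-pairing : ∀ {α β} → IsRoot α → IsRoot β → α ≡ β ⊎ form α β ≤ + 1
root-pairing {β = β} (u , i , refl) rβ =
  Sum.map equal bounded (listed-pairing i (listed-root (root-act (reverse u) rβ)))
  where
  equal : act (reverse u) β ≡ simple i → act u (simple i) ≡ β
  equal eq = trans (cong (act u) (sym eq)) (act-reverse u β)
  bounded : form (simple i) (act (reverse u) β) ≤ + 1 → form (act u (simple i)) β ≤ + 1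
  bounded = subst (_≤ + 1) (sym (act-adjoint u (simple i) β))

reflection-involutive : ∀ {t β} → HasRoot t β → ∀ x → act t (act t x) ≡ x
reflection-involutive {t} {β} ((rβ , _) , tβ) x = begin
  act t (act t x)      ≡⟨ tβ (act t x) ⟩
  reflV β (act t x)    ≡⟨ cong (reflV β) (tβ x) ⟩
  reflV β (reflV β x)  ≡⟨ reflV-involutive {β} (root-norm rβ) x ⟩
  x                    ∎

·-involutive : ∀ {t β} → HasRoot t β → ∀ w → ((w · t) · t) ≈ w
·-involutive {t} hβ w x = begin
  act ((w ++ t) ++ t) x   ≡⟨ act-++ (w ++ t) t x ⟩
  act (w ++ t) (act t x)  ≡⟨ act-++ w t (act t x) ⟩
  act w (act t (act t x)) ≡⟨ cong (act w) (reflection-involutive {t} hβ x) ⟩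
  act w x                 ∎

conj-cancel : ∀ {t β r} → HasRoot t β → conj r t ≈ t → r ≈ t
conj-cancel {t} {β} {r} hβ rᵗ≈t x = begin
  act r x                                 ≡⟨ involution (act r x) ⟨
  act t (act t (act r x))                 ≡⟨ cong (act t ∘ act t ∘ act r) (involution x) ⟨
  act t (act t (act r (act t (act t x)))) ≡⟨ cong (act t) (act-conj r t (act t x)) ⟨
  act t (act (conj r t) (act t x))        ≡⟨ cong (act t) (rᵗ≈t (act t x)) ⟩
  act t (act t (act t x))                 ≡⟨ involution (act t x) ⟩
  act t x                                 ∎
  where
  involution = reflection-involutive {t} hβ

Shortening : Word → Word → Set
Shortening w t = ∃ λ d → d ≈ (w · t) × length d ℕ.< length w

exchange : ∀ {t β} → HasRoot t β → ∀ w → Nonpos (act w β) → Shortening w t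
exchange ((rβ , β≥0) , _) [] β≤0 = ⊥-elim (root-sign-unique rβ β≥0 β≤0)
exchange {t} {β} hβ@((rβ , _) , tβ) (i ∷ w) siwβ≤0 =
  Sum.[ ascending , descending ] (root-sign (root-act w rβ))
  where
  descending : Nonpos (act w β) → Shortening (i ∷ w) t
  descending wβ≤0 = prepend (exchange hβ w wβ≤0)
    where
    prepend : Shortening w t → Shortening (i ∷ w) t
    prepend (d , d≈wt , shorter) = i ∷ d , cong (reflV (simple i)) ∘ d≈wt , s≤s shorter
  ascending : Nonneg (act w β) → Shortening (i ∷ w) t
  ascending wβ≥0 = w , w≈siwt , ℕ.n<1+n (length w)
    where
    wβ≡αᵢ : act w β ≡ simple i
    wβ≡αᵢ = simple-exchange i (root-act w rβ) wβ≥0 siwβ≤0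
    w≈siwt : w ≈ ((i ∷ w) · t)
    w≈siwt x = sym (begin
      reflV (simple i) (act (w ++ t) x)            ≡⟨ cong (reflV (simple i)) (act-++ w t x) ⟩
      reflV (simple i) (act w (act t x))           ≡⟨ cong (reflV (simple i) ∘ act w) (tβ x) ⟩
      reflV (simple i) (act w (reflV β x))         ≡⟨ cong (reflV (simple i)) (act-reflV w β x) ⟩
      reflV (simple i) (reflV (act w β) (act w x)) ≡⟨ cancel wβ≡αᵢ ⟩
      act w x                                      ∎)
      where
      cancel : ∀ {a} → a ≡ simple i → reflV (simple i) (reflV a (act w x)) ≡ act w x
      cancel refl = reflV-involutive {simple i} (simple-norm i) (act w x)

-- Length and the Bruhat order

·-congʳ : ∀ {u w} t → u ≈ w → (u · t) ≈ (w · t)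
·-congʳ {u} {w} t u≈w x = trans (act-++ u t x) (trans (u≈w (act t x)) (sym (act-++ w t x)))

word-of-length? : ∀ {P : Word → Set} → (∀ u → Dec (P u)) → ∀ k → Dec (∃ λ u → P u × length u ≡ k)
word-of-length? P? zero with P? []
... | yes p = yes ([] , p , refl)
... | no ¬p = no λ { ([] , p , _) → ¬p p }
word-of-length? P? (suc k) =
  map′ (λ { (u , (i , p) , refl) → i ∷ u , p , refl })
       (λ { (i ∷ u , p , refl) → u , (i , p) , refl })
       (word-of-length? (λ u → Fin.any? λ i → P? (i ∷ u)) k)

module _ {P : ℕ → Set} (P? : ∀ n → Dec (P n)) where

  least-below : ∀ n {k} → k ℕ.≤ n → P k → ∃ λ m → P m × ∀ {j} → P j → m ℕ.≤ j
  least-below n {k} k≤n pk with ℕ.anyUpTo? P? n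
  least-below n       {k} k≤n pk | no none =
    k , pk , λ pj → ℕ.≮⇒≥ λ j<k → none (_ , ℕ.<-≤-trans j<k k≤n , pj)
  least-below (suc n)     _   _  | yes (j , s≤s j≤n , pj) = least-below n j≤n pj

  least-witness : ∀ {k} → P k → ∃ λ m → P m × ∀ {j} → P j → m ℕ.≤ j
  least-witness {k} = least-below k ℕ.≤-refl

Expressible : Word → ℕ → Set
Expressible w m = ∃ λ u → u ≈ w × length u ≡ m

length-exists : ∀ w → ∃ (HasLength w)
length-exists w = shortest (least-witness (word-of-length? (_≈? w)) (w , (λ _ → refl) , refl))
  where
  shortest : (∃ λ m → Expressible w m × ∀ {j} → Expressible w j → m ℕ.≤ j) → ∃ (HasLength w)
  shortest (m , word , least) = m , word , λ u u≈w → least (u , u≈w , refl)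

ℓ : Word → ℕ
ℓ w = proj₁ (length-exists w)

ℓ-length : ∀ w → HasLength w (ℓ w)
ℓ-length w = proj₂ (length-exists w)

HasLength-unique : ∀ {w m n} → HasLength w m → HasLength w n → m ≡ n
HasLength-unique ((u , u≈w , refl) , m-least) ((u′ , u′≈w , refl) , n-least) =
  ℕ.≤-antisym (m-least u′ u′≈w) (n-least u u≈w)

ℓ-unique : ∀ {w n} → HasLength w n → ℓ w ≡ n
ℓ-unique {w} = HasLength-unique {w} (ℓ-length w)

HasLength-cong : ∀ {u w n} → u ≈ w → HasLength u n → HasLength w n
HasLength-cong u≈w ((v , v≈u , len) , least) =
  (v , (λ x → trans (v≈u x) (u≈w x)) , len) ,
  λ v′ v′≈w → least v′ λ x → trans (v′≈w x) (sym (u≈w x))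

ℓ-cong : ∀ {u w} → u ≈ w → ℓ u ≡ ℓ w
ℓ-cong {u} {w} u≈w = sym (ℓ-unique {w} (HasLength-cong {u} {w} u≈w (ℓ-length u)))

step⇒ℓ< : ∀ {u w} → BruhatStep u w → ℓ u ℕ.< ℓ w
step⇒ℓ< {u} {w} (_ , _ , _ , hm , hn , m<n) = subst₂ ℕ._<_ (sym (ℓ-unique {u} hm)) (sym (ℓ-unique {w} hn)) m<n

<B⇒ℓ< : ∀ {u w} → u <B w → ℓ u ℕ.< ℓ w
<B⇒ℓ< {u} {w} [ step ]                = step⇒ℓ< {u} {w} step
<B⇒ℓ< {u} {w} (_∷_ {y = v} step steps) = ℕ.<-trans (step⇒ℓ< {u} {v} step) (<B⇒ℓ< steps)

ℓ-descent : ∀ {t β} → HasRoot t β → ∀ w → Nonpos (act w β) → ℓ (w · t) ℕ.< ℓ w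
ℓ-descent {t} {β} hβ w wβ≤0 = shorten (ℓ-length w)
  where
  shorten : HasLength w (ℓ w) → ℓ (w · t) ℕ.< ℓ w
  shorten ((u , u≈w , len) , _) =
    subst (ℓ (w · t) ℕ.<_) len (descend (exchange hβ u (subst Nonpos (sym (u≈w β)) wβ≤0)))
    where
    descend : Shortening u t → ℓ (w · t) ℕ.< length u
    descend (d , d≈ut , shorter) =
      ℕ.≤-<-trans (proj₂ (ℓ-length (w · t)) d λ x → trans (d≈ut x) (·-congʳ {u} {w} t u≈w x)) shorter

ℓ-ascent : ∀ {t β} → HasRoot t β → ∀ w → Nonneg (act w β) → ℓ w ℕ.< ℓ (w · t)
ℓ-ascent {t} {β} hβ@((rβ , _) , tβ) w wβ≥0 =
  subst (ℕ._< ℓ (w · t)) (ℓ-cong {(w · t) · t} {w} (·-involutive hβ w)) (ℓ-descent hβ (w · t) wtβ≤0)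
  where
  wtβ≤0 : Nonpos (act (w · t) β)
  wtβ≤0 = subst Nonpos (sym (begin
    act (w ++ t) β                 ≡⟨ act-++ w t β ⟩
    act w (act t β)                ≡⟨ cong (act w) (tβ β) ⟩
    act w (reflV β β)              ≡⟨ cong (act w) (reflV-self {β} (root-norm rβ)) ⟩
    act w (β -V ((+ 2) ·V β))      ≡⟨ act-axpy w β β (+ 2) ⟩
    act w β -V ((+ 2) ·V act w β)  ∎)) (Nonpos-negated wβ≥0)

A-characterisation : ∀ {t β} → HasRoot t β → ∀ w → InA w t ⇔ Nonneg (act w β)
A-characterisation {t} {β} hβ@((rβ , _) , _) w = mk⇔ to from
  where
  to : InA w t → Nonneg (act w β)
  to (_ , w<wt) = Sum.[ id , (λ wβ≤0 → ⊥-elim (ℕ.<-asym (<B⇒ℓ< w<wt) (ℓ-descent hβ w wβ≤0))) ]′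
                  (root-sign (root-act w rβ))
  from : Nonneg (act w β) → InA w t
  from wβ≥0 = (β , hβ) , [ (t , (β , hβ) , λ _ → refl) ,
                           ℓ w , ℓ (w · t) , ℓ-length w , ℓ-length (w · t) , ℓ-ascent hβ w wβ≥0 ]

D-characterisation : ∀ {t β} → HasRoot t β → ∀ w → InD w t ⇔ Nonpos (act w β)
D-characterisation {t} {β} hβ@((rβ , _) , _) w = mk⇔ to from
  where
  to : InD w t → Nonpos (act w β)
  to (_ , wt<w) = Sum.[ (λ wβ≥0 → ⊥-elim (ℕ.<-asym (<B⇒ℓ< wt<w) (ℓ-ascent hβ w wβ≥0))) , id ]′
                  (root-sign (root-act w rβ))
  from : Nonpos (act w β) → InD w t
  from wβ≤0 = (β , hβ) , [ (t , (β , hβ) , λ x → sym (·-involutive hβ w x)) ,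
                           ℓ (w · t) , ℓ w , ℓ-length (w · t) , ℓ-length w , ℓ-descent hβ w wβ≤0 ]

A⊎D : ∀ {t β} → HasRoot t β → ∀ w → InA w t ⊎ InD w t
A⊎D hβ@((rβ , _) , _) w =
  Sum.map (Equivalence.from (A-characterisation hβ w)) (Equivalence.from (D-characterisation hβ w))
          (root-sign (root-act w rβ))

≤1⇒≤0⊎≡1 : ∀ {c} → c ≤ + 1 → c ≤ 0ℤ ⊎ c ≡ + 1
≤1⇒≤0⊎≡1 {+ 0}           _                = inj₁ ℤ.≤-refl
≤1⇒≤0⊎≡1 {+ 1}           _                = inj₂ refl
≤1⇒≤0⊎≡1 {+ suc (suc n)} (ℤ.+≤+ (s≤s ()))
≤1⇒≤0⊎≡1 { -[1+ n ]}     _                = inj₁ ℤ.-≤+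

pairing-one : ∀ {t r β ρ} → HasRoot t β → HasRoot r ρ → InD t r → ¬ (r ≈ t) → form β ρ ≡ + 1
pairing-one {t} {r} {β} {ρ} hβ@((rβ , β≥0) , tβ) hρ@((rρ , ρ≥0) , rρ′) r∈Dₜ r≉t =
  Sum.[ (λ β≡ρ → ⊥-elim (r≉t (same-reflection β≡ρ))) , positive ]′ (root-pairing rβ rρ)
  where
  same-reflection : β ≡ ρ → r ≈ t
  same-reflection refl x = trans (rρ′ x) (sym (tβ x))
  tρ≤0 : Nonpos (reflV β ρ)
  tρ≤0 = subst Nonpos (tβ ρ) (Equivalence.to (D-characterisation hρ t) r∈Dₜ)
  positive : form β ρ ≤ + 1 → form β ρ ≡ + 1
  positive c≤1 = Sum.[ (λ c≤0 → ⊥-elim (not-nonneg c≤0)) , id ]′ (≤1⇒≤0⊎≡1 c≤1)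
    where
    not-nonneg : form β ρ ≤ 0ℤ → ⊥
    not-nonneg c≤0 = root-sign-unique (subst IsRoot (tβ ρ) (root-act t rρ)) (Nonneg-axpy c≤0 ρ≥0 β≥0) tρ≤0

conjugate-root : ∀ {t r β ρ} → HasRoot t β → HasRoot r ρ → InD t r → form β ρ ≡ + 1 →
  HasRoot (conj r t) (β -V ρ)
conjugate-root {t} {r} {β} {ρ} hβ@(_ , tβ) hρ@((rρ , _) , rρ′) r∈Dₜ c≡1 =
  (subst IsRoot negated (root-negated (root-act t rρ)) , subst Nonneg negated (Nonneg-negated tρ≤0)) , acts
  where
  γ = act t ρ
  tρ≤0 : Nonpos γ
  tρ≤0 = Equivalence.to (D-characterisation hρ t) r∈Dₜ
  negated : γ -V ((+ 2) ·V γ) ≡ β -V ρ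
  negated = trans (cong (λ y → y -V ((+ 2) ·V y)) (trans (tβ ρ) (cong (λ c → ρ -V (c ·V β)) c≡1)))
                  (-ᵥ-negated β ρ)
  acts : ∀ x → act (conj r t) x ≡ reflV (β -V ρ) x
  acts x = begin
    act (conj r t) x                 ≡⟨ act-conj r t x ⟩
    act t (act r (act t x))          ≡⟨ cong (act t) (rρ′ (act t x)) ⟩
    act t (reflV ρ (act t x))        ≡⟨ act-reflV t ρ (act t x) ⟩
    reflV γ (act t (act t x))        ≡⟨ cong (reflV γ) (reflection-involutive {t} hβ x) ⟩
    reflV γ x                        ≡⟨ reflV-negated γ x ⟨
    reflV (γ -V ((+ 2) ·V γ)) x      ≡⟨ cong (λ a → reflV a x) negated ⟩
    reflV (β -V ρ) x                 ∎

below-minimal : ∀ {u v t s} → MinimalAD u v t → s ⪯ t → ¬ (s ≈ t) → ¬ InAD u v s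
below-minimal (_ , minimal) s⪯t s≉t s∈AD = s≉t (minimal _ s∈AD s⪯t)

A-transfer : ∀ {u v s σ} → HasRoot s σ → ¬ InAD u v s → InA u s → InA v s
A-transfer {v = v} hσ s∉AD s∈Aᵤ =
  Sum.[ id , (λ s∈Dᵥ → ⊥-elim (s∉AD (s∈Aᵤ , s∈Dᵥ))) ]′ (A⊎D hσ v)

D-transfer : ∀ {u v s σ} → HasRoot s σ → ¬ InAD u v s → InD v s → InD u s
D-transfer {u = u} hσ s∉AD s∈Dᵥ =
  Sum.[ (λ s∈Aᵤ → ⊥-elim (s∉AD (s∈Aᵤ , s∈Dᵥ))) , id ]′ (A⊎D hσ u)

D-difference : ∀ {t r s β ρ} → HasRoot t β → HasRoot r ρ → HasRoot s (β -V ρ) →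
  ∀ w → InD w t → InA w r → InD w s
D-difference {β = β} {ρ} hβ hρ hσ w t∈D r∈A =
  Equivalence.from (D-characterisation hσ w) (subst Nonpos (sym (act-sub w β ρ))
    (Nonpos-sub (Equivalence.to (D-characterisation hβ w) t∈D) (Equivalence.to (A-characterisation hρ w) r∈A)))

A-difference : ∀ {t r s β ρ} → HasRoot t β → HasRoot r ρ → HasRoot s (β -V ρ) →
  ∀ w → InA w t → InD w s → InA w r
A-difference {β = β} {ρ} hβ hρ hσ w t∈A s∈D =
  Equivalence.from (A-characterisation hρ w) (subst Nonneg complement
    (Nonneg-sub (Equivalence.to (A-characterisation hβ w) t∈A) (Equivalence.to (D-characterisation hσ w) s∈D)))
  where
  complement : act w β -V act w (β -V ρ) ≡ act w ρ
  complement = trans (cong (act w β -V_) (act-sub w β ρ)) (-ᵥ-complement (act w β) (act w ρ))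

⇔-cycle : ∀ {P Q R S : Set} → (P → Q) → (Q → R) → (R → S) → (S → P) →
  (P ⇔ Q) × (Q ⇔ R) × (R ⇔ S)
⇔-cycle pq qr rs sp = mk⇔ pq (sp ∘ rs ∘ qr) , mk⇔ qr (pq ∘ sp ∘ rs) , mk⇔ rs (qr ∘ pq ∘ sp)

theorem4p9 : (u v t : Word) →
    (∃ λ s → InAD u v s) →
    MinimalAD u v t →
    ∀ r → InD t r → ¬ (r ≈ t) →
    ((InA u r ⇔ InA v r) × (InA v r ⇔ InD v (conj r t)) × (InD v (conj r t) ⇔ InD u (conj r t)))
theorem4p9 u v t _ t-minimal@((t∈Aᵤ@((β , hβ) , _) , t∈Dᵥ) , _)
           r r∈Dₜ@((ρ , hρ@((_ , ρ≥0) , _)) , _) r≉t =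
  ⇔-cycle (A-transfer hρ r∉AD) (D-difference hβ hρ hα v t∈Dᵥ)
          (D-transfer hα rᵗ∉AD) (A-difference hβ hρ hα u t∈Aᵤ)
  where
  hα : HasRoot (conj r t) (β -V ρ)
  hα = conjugate-root hβ hρ r∈Dₜ (pairing-one hβ hρ r∈Dₜ r≉t)
  r∉AD : ¬ InAD u v r
  r∉AD = below-minimal t-minimal (ρ , β , hρ , hβ , proj₂ (proj₁ hα)) r≉t
  rᵗ∉AD : ¬ InAD u v (conj r t)
  rᵗ∉AD = below-minimal t-minimal (β -V ρ , β , hα , hβ , subst Nonneg (sym (-ᵥ-complement β ρ)) ρ≥0)
                        (r≉t ∘ conj-cancel {t} {β} {r} hβ)
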